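{- Let $n_1,\dots,n_p$ be pairwise distinct positive integers and $\theta_1,\dots,\theta_p$ positive integers, and let $G$ be the complete multipartite graph on $N=\sum_i\theta_i n_i$ vertices whose parts are $P^i_j$ ($1\le i\le p$, $1\le j\le\theta_i$) with $|P^i_j|=n_i$ (two vertices adjacent iff they lie in distinct parts). For $i\in\{1,\dots,p\}$ and distinct $j,k\in\{1,\dots,\theta_i\}$ define $g^i_{jk}:V(G)\to\mathbb{R}$ by $g^i_{jk}(v)=1$ if $v\in P^i_j$, $-1$ if $v\in P^i_k$, and $0$ otherwise. For distinct vertices $v,w$ define $f_{v,w}(u)=1$ if $u=v$, $-1$ if $u=w$, and $0$ otherwise. Then the eigenfunctions of the normalized Laplacian of $G$ corresponding to the eigenvalue $N/(N-n_i)$ are precisely the (nonzero) linear combinations of the functions $g^i_{jk}$; and the eigenfunctions corresponding to the eigenvalue $1$ are precisely the (nonzero) linear combinations of the functions $f_{v,w}$ with $v,w$ belonging to the same part.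
   Context: The normalized Laplacian is $L=I-D^{ -1}A$ with $A$ the adjacency matrix and $D$ the diagonal degree matrix; as an operator, $Lf(v)=f(v)-\frac{1}{\deg v}\sum_{w\sim v}f(w)$.
   Formalization: Functions on the vertices of G and the coefficients of the linear combinations take values in ℚ instead of ℝ. -}

module Defs where

open import Data.Nat as ℕ using (ℕ; zero; suc)
open import Data.Integer using (+_)
open import Data.Rational using (ℚ; 0ℚ; 1ℚ; _+_; _*_; _-_; -_; _/_)
open import Data.Fin using (Fin; zero; suc)
open import Data.Fin.Properties using (_≟_)
open import Data.Product using (Σ; _,_; proj₁; proj₂; _×_; ∃)
open import Data.Product.Properties using (≡-dec)
open import Data.Bool using (if_then_else_)
open import Relation.Nullary using (¬_; does)
open import Relation.Binary.PropositionalEquality using (_≡_)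
open import Relation.Binary.Definitions using (DecidableEquality)

sumℕ : (m : ℕ) → (Fin m → ℕ) → ℕ
sumℕ zero    f = 0
sumℕ (suc m) f = f zero ℕ.+ sumℕ m (λ i → f (suc i))

sumℚ : (m : ℕ) → (Fin m → ℚ) → ℚ
sumℚ zero    f = 0ℚ
sumℚ (suc m) f = f zero + sumℚ m (λ i → f (suc i))

-- 1/k as a rational (junk value 0 for k = 0; never used under the hypotheses)
recipℕ : ℕ → ℚ
recipℕ zero    = 0ℚ
recipℕ (suc k) = + 1 / suc k

frac : ℕ → ℕ → ℚ
frac a b = (+ a / 1) * recipℕ b

Part : (p : ℕ) → (θ : Fin p → ℕ) → Set
Part p θ = Σ (Fin p) (λ i → Fin (θ i))

Vertex : (p : ℕ) → (n θ : Fin p → ℕ) → Set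
Vertex p n θ = Σ (Part p θ) (λ P → Fin (n (proj₁ P)))

_≟P_ : ∀ {p θ} → DecidableEquality (Part p θ)
_≟P_ = ≡-dec _≟_ _≟_

_≟V_ : ∀ {p n θ} → DecidableEquality (Vertex p n θ)
_≟V_ = ≡-dec _≟P_ _≟_

numVertices : (p : ℕ) → (n θ : Fin p → ℕ) → ℕ
numVertices p n θ = sumℕ p (λ i → θ i ℕ.* n i)

numParts : (p : ℕ) → (θ : Fin p → ℕ) → ℕ
numParts p θ = sumℕ p θ

sumPart : ∀ p θ → (Part p θ → ℚ) → ℚ
sumPart p θ g = sumℚ p (λ i → sumℚ (θ i) (λ j → g (i , j)))

sumPartℕ : ∀ p θ → (Part p θ → ℕ) → ℕ
sumPartℕ p θ g = sumℕ p (λ i → sumℕ (θ i) (λ j → g (i , j)))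

sumV : ∀ p n θ → (Vertex p n θ → ℚ) → ℚ
sumV p n θ g = sumPart p θ (λ P → sumℚ (n (proj₁ P)) (λ a → g (P , a)))

sumVℕ : ∀ p n θ → (Vertex p n θ → ℕ) → ℕ
sumVℕ p n θ g = sumPartℕ p θ (λ P → sumℕ (n (proj₁ P)) (λ a → g (P , a)))

adjℕ : ∀ {p n θ} → Vertex p n θ → Vertex p n θ → ℕ
adjℕ v w = if does (proj₁ v ≟P proj₁ w) then 0 else 1

degree : ∀ p n θ → Vertex p n θ → ℕ
degree p n θ v = sumVℕ p n θ (λ w → adjℕ v w)

neighbourSum : ∀ p n θ → (Vertex p n θ → ℚ) → Vertex p n θ → ℚ
neighbourSum p n θ f v =
  sumV p n θ (λ w → if does (proj₁ v ≟P proj₁ w) then 0ℚ else f w)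

laplacian : ∀ p n θ → (Vertex p n θ → ℚ) → Vertex p n θ → ℚ
laplacian p n θ f v = f v - recipℕ (degree p n θ v) * neighbourSum p n θ f v

IsEigenfunction : ∀ p n θ → ℚ → (Vertex p n θ → ℚ) → Set
IsEigenfunction p n θ λ' f =
  (∃ λ v → ¬ f v ≡ 0ℚ) × (∀ v → laplacian p n θ f v ≡ λ' * f v)

gFun : ∀ {p n θ} (i : Fin p) (j k : Fin (θ i)) → Vertex p n θ → ℚ
gFun i j k v =
  if does (proj₁ v ≟P (i , j)) then 1ℚ
  else (if does (proj₁ v ≟P (i , k)) then - 1ℚ else 0ℚ)

fFun : ∀ {p n θ} (v w : Vertex p n θ) → Vertex p n θ → ℚ
fFun v w u = if does (u ≟V v) then 1ℚ else (if does (u ≟V w) then - 1ℚ else 0ℚ)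

InSpanG : ∀ p n θ → (i : Fin p) → (Vertex p n θ → ℚ) → Set
InSpanG p n θ i h =
  Σ (Fin (θ i) → Fin (θ i) → ℚ) λ c → ∀ u →
    h u ≡ sumℚ (θ i) (λ j → sumℚ (θ i) (λ k →
            if does (j ≟ k) then 0ℚ else c j k * gFun i j k u))

InSpanF : ∀ p n θ → (Vertex p n θ → ℚ) → Set
InSpanF p n θ h =
  Σ (Vertex p n θ → Vertex p n θ → ℚ) λ c → ∀ u →
    h u ≡ sumV p n θ (λ v → sumV p n θ (λ w →
            if does (proj₁ v ≟P proj₁ w)
            then (if does (v ≟V w) then 0ℚ else c v w * fFun v w u)
            else 0ℚ))

module Submission where

-- In the complete multipartite graph the neighbour sum of f at v is S − S_P, where S is the sum of f
-- over all vertices and S_P its sum over the part P of v, and deg v = N − n_v.  So Lf = μ f at v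
-- says S − S_P = (1 − μ) · deg v · f(v).
--
-- μ = 1: every part sum equals S; summing over the (at least two) parts gives S = 0, so all part
-- sums vanish.  Such f are exactly Σ_v f(v) (δ_v − δ_{b(v)}), b(v) a fixed vertex of the part of v.
--
-- μ = N/(N − n_i): multiplied by N − n_i the equation reads (N − n_i)(S_P − S) = n_i · deg v · f(v).
-- The left side depends only on P, so f is constant on parts, and then (N − n_i) S = N (n_v − n_i) f(v).
-- At a vertex with n_v = n_i this gives S = 0, and as the sizes are distinct f vanishes off the parts
-- P^i_j.  Such f, with value a_j on P^i_j and Σ_j a_j = 0, are exactly Σ_j a_j g^i_{j k₀}.

open import Defs
open import Axiom.UniquenessOfIdentityProofs.WithK using (uip)
open import Data.Bool using (true; false; if_then_else_)
open import Data.Bool.Properties using (if-float)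
open import Data.Empty using (⊥-elim)
open import Data.Fin using (Fin; zero; suc; fromℕ<)
open import Data.Fin.Properties using (_≟_; suc-injective)
import Data.Integer as ℤ
import Data.Integer.Properties as ℤ
open import Data.Nat as ℕ using (ℕ; zero; suc; _≤_; _∸_; s≤s)
import Data.Nat.Coprimality as Coprime
import Data.Nat.Properties as ℕ
open import Data.Product using (Σ; _×_; _,_; proj₁; ∃)
open import Data.Product.Function.NonDependent.Propositional using (_×-⇔_)
open import Data.Product.Properties using (,-injectiveˡ; ,-injectiveʳ-UIP)
open import Data.Rational using (ℚ; 0ℚ; 1ℚ; _+_; _*_; _-_; -_; _/_; mkℚ; ↥_; 1/_; ≢-nonZero)
open import Data.Rational.Properties
  using ( ↥p/↧p≡p; +-*-ring; +-assoc; *-comm; +-identityˡ; +-identityʳ; +-inverseʳ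
        ; *-identityˡ; *-identityʳ; *-zeroˡ; *-zeroʳ; *-inverseˡ; *-distribˡ-+ )
open import Algebra.Properties.Ring +-*-ring using (x∙y⁻¹≈ε⇒x≈y; x[y-z]≈xy-xz; -1*x≈-x)
open import Data.Rational.Solver using (module +-*-Solver)
open import Function using (_∘_)
open import Function.Bundles using (_⇔_; mk⇔; module Equivalence)
open import Function.Construct.Composition using (_⇔-∘_)
open import Function.Construct.Identity using (⇔-id)
open import Function.Construct.Symmetry using (⇔-sym)
open import Relation.Binary.PropositionalEquality
open import Relation.Nullary using (¬_; Dec; yes; no; does)
open import Relation.Nullary.Decidable using (dec-true; dec-false)

open +-*-Solver
open ≡-Reasoning
open Equivalence using (to; from)

fromℕ : ℕ → ℚ
fromℕ a = ℤ.+ a / 1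

fromℕ≡mkℚ : ∀ a → fromℕ a ≡ mkℚ (ℤ.+ a) 0 (Coprime.sym (Coprime.1-coprimeTo a))
fromℕ≡mkℚ a = ↥p/↧p≡p (mkℚ (ℤ.+ a) 0 _)

-- After rewriting fromℕ a to its normal form, 1ℚ + fromℕ a computes to (+ 1 ℤ.+ + a ℤ.* + 1) / 1.
fromℕ-suc : ∀ a → fromℕ (suc a) ≡ 1ℚ + fromℕ a
fromℕ-suc a rewrite fromℕ≡mkℚ a = cong (_/ 1) (cong (λ z → ℤ.+ 1 ℤ.+ z) (sym (ℤ.*-identityʳ (ℤ.+ a))))

fromℕ-+ : ∀ a b → fromℕ (a ℕ.+ b) ≡ fromℕ a + fromℕ b
fromℕ-+ zero    b = sym (+-identityˡ (fromℕ b))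
fromℕ-+ (suc a) b = begin
  fromℕ (suc (a ℕ.+ b))     ≡⟨ fromℕ-suc (a ℕ.+ b) ⟩
  1ℚ + fromℕ (a ℕ.+ b)      ≡⟨ cong (1ℚ +_) (fromℕ-+ a b) ⟩
  1ℚ + (fromℕ a + fromℕ b)  ≡⟨ sym (+-assoc 1ℚ (fromℕ a) (fromℕ b)) ⟩
  (1ℚ + fromℕ a) + fromℕ b  ≡⟨ cong (_+ fromℕ b) (sym (fromℕ-suc a)) ⟩
  fromℕ (suc a) + fromℕ b   ∎

fromℕ-* : ∀ a b → fromℕ (a ℕ.* b) ≡ fromℕ a * fromℕ b
fromℕ-* zero    b = sym (*-zeroˡ (fromℕ b))
fromℕ-* (suc a) b = begin
  fromℕ (b ℕ.+ a ℕ.* b)        ≡⟨ fromℕ-+ b (a ℕ.* b) ⟩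
  fromℕ b + fromℕ (a ℕ.* b)    ≡⟨ cong (fromℕ b +_) (fromℕ-* a b) ⟩
  fromℕ b + fromℕ a * fromℕ b  ≡⟨ solve 2 (λ x y → y :+ x :* y := (con 1ℚ :+ x) :* y) refl (fromℕ a) (fromℕ b) ⟩
  (1ℚ + fromℕ a) * fromℕ b     ≡⟨ cong (_* fromℕ b) (sym (fromℕ-suc a)) ⟩
  fromℕ (suc a) * fromℕ b      ∎

fromℕ-injective : ∀ {a b} → fromℕ a ≡ fromℕ b → a ≡ b
fromℕ-injective {a} {b} eq =
  ℤ.+-injective (trans (cong ↥_ (sym (fromℕ≡mkℚ a))) (trans (cong ↥_ eq) (cong ↥_ (fromℕ≡mkℚ b))))

fromℕ-nonZero : ∀ {a} → 1 ≤ a → fromℕ a ≢ 0ℚ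
fromℕ-nonZero {suc a} _ eq with fromℕ-injective {suc a} {0} eq
... | ()

recipℕ-inverseˡ : ∀ a → 1 ≤ a → recipℕ a * fromℕ a ≡ 1ℚ
recipℕ-inverseˡ (suc a) _ = trans
  (cong₂ _*_ (↥p/↧p≡p (mkℚ (ℤ.+ 1) a (Coprime.1-coprimeTo (suc a)))) (fromℕ≡mkℚ (suc a)))
  (*-inverseˡ (mkℚ (ℤ.+ suc a) 0 (Coprime.sym (Coprime.1-coprimeTo (suc a)))))

difference-⇔ : ∀ {x y z w} → x - y ≡ z - w → (x ≡ y ⇔ z ≡ w)
difference-⇔ {x} {y} {z} {w} eq = mk⇔
  (λ x≡y → x∙y⁻¹≈ε⇒x≈y z w (trans (sym eq) (trans (cong (λ t → x - t) (sym x≡y)) (+-inverseʳ x))))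
  (λ z≡w → x∙y⁻¹≈ε⇒x≈y x y (trans eq (trans (cong (λ t → z - t) (sym z≡w)) (+-inverseʳ z))))

*-cancelˡ-≢0 : ∀ x {y z} → x ≢ 0ℚ → x * y ≡ x * z → y ≡ z
*-cancelˡ-≢0 x {y} {z} x≢0 eq = begin
  y              ≡⟨ sym (*-identityˡ y) ⟩
  1ℚ * y         ≡⟨ cong (_* y) (sym x⁻¹x≡1) ⟩
  (x⁻¹ * x) * y  ≡⟨ solve 3 (λ x x⁻¹ y → (x⁻¹ :* x) :* y := x⁻¹ :* (x :* y)) refl x x⁻¹ y ⟩
  x⁻¹ * (x * y)  ≡⟨ cong (x⁻¹ *_) eq ⟩
  x⁻¹ * (x * z)  ≡⟨ solve 3 (λ x x⁻¹ z → x⁻¹ :* (x :* z) := (x⁻¹ :* x) :* z) refl x x⁻¹ z ⟩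
  (x⁻¹ * x) * z  ≡⟨ cong (_* z) x⁻¹x≡1 ⟩
  1ℚ * z         ≡⟨ *-identityˡ z ⟩
  z              ∎
  where
  x⁻¹ : ℚ
  x⁻¹ = (1/ x) {{≢-nonZero x≢0}}
  x⁻¹x≡1 : x⁻¹ * x ≡ 1ℚ
  x⁻¹x≡1 = *-inverseˡ x {{≢-nonZero x≢0}}

x*y≡0⇒y≡0 : ∀ x {y} → x ≢ 0ℚ → x * y ≡ 0ℚ → y ≡ 0ℚ
x*y≡0⇒y≡0 x x≢0 eq = *-cancelˡ-≢0 x x≢0 (trans eq (sym (*-zeroʳ x)))

x≢y⇒x-y≢0 : ∀ {x y} → x ≢ y → x - y ≢ 0ℚ
x≢y⇒x-y≢0 {x} {y} x≢y eq = x≢y (x∙y⁻¹≈ε⇒x≈y x y eq)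

x*y≡y⇒y≡0 : ∀ x {y} → x ≢ 1ℚ → x * y ≡ y → y ≡ 0ℚ
x*y≡y⇒y≡0 x {y} x≢1 eq = x*y≡0⇒y≡0 (x - 1ℚ) (x≢y⇒x-y≢0 x≢1) (begin
  (x - 1ℚ) * y  ≡⟨ solve 2 (λ x y → (x :- con 1ℚ) :* y := x :* y :- y) refl x y ⟩
  x * y - y     ≡⟨ cong (λ t → t - y) eq ⟩
  y - y         ≡⟨ +-inverseʳ y ⟩
  0ℚ            ∎)

inverse⇒≢0 : ∀ {r d} → r * d ≡ 1ℚ → d ≢ 0ℚ
inverse⇒≢0 {r} rd≡1 d≡0 with trans (sym rd≡1) (trans (cong (r *_) d≡0) (*-zeroʳ r))
... | ()

inverse-⇔ : ∀ r d {X Y} → r * d ≡ 1ℚ → (r * X ≡ Y ⇔ X ≡ d * Y)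
inverse-⇔ r d {X} {Y} rd≡1 = mk⇔
  (λ rX≡Y → trans (sym (d*[r*x]≡x X)) (cong (d *_) rX≡Y))
  (λ X≡dY → trans (cong (r *_) X≡dY) (r*[d*x]≡x Y))
  where
  r*[d*x]≡x : ∀ x → r * (d * x) ≡ x
  r*[d*x]≡x x = begin
    r * (d * x)  ≡⟨ solve 3 (λ r d x → r :* (d :* x) := (r :* d) :* x) refl r d x ⟩
    (r * d) * x  ≡⟨ cong (_* x) rd≡1 ⟩
    1ℚ * x       ≡⟨ *-identityˡ x ⟩
    x            ∎
  d*[r*x]≡x : ∀ x → d * (r * x) ≡ x
  d*[r*x]≡x x = trans (solve 3 (λ r d x → d :* (r :* x) := r :* (d :* x)) refl r d x) (r*[d*x]≡x x)

eigenvalueEquation-⇔ : ∀ {r d} a X μ → r * d ≡ 1ℚ →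
                       (a - r * X ≡ μ * a ⇔ X ≡ (1ℚ - μ) * (d * a))
eigenvalueEquation-⇔ {r} {d} a X μ rd≡1 = mk⇔
  (λ eq → trans (to (inverse-⇔ r d rd≡1) (sym (to rearrange eq))) reassoc)
  (λ eq → from rearrange (sym (from (inverse-⇔ r d rd≡1) (trans eq (sym reassoc)))))
  where
  rearrange : a - r * X ≡ μ * a ⇔ (1ℚ - μ) * a ≡ r * X
  rearrange = difference-⇔
    (solve 3 (λ a rX μ → (a :- rX) :- μ :* a := (con 1ℚ :- μ) :* a :- rX) refl a (r * X) μ)
  reassoc : d * ((1ℚ - μ) * a) ≡ (1ℚ - μ) * (d * a)
  reassoc = solve 3 (λ d a μ → d :* ((con 1ℚ :- μ) :* a) := (con 1ℚ :- μ) :* (d :* a)) refl d a μ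

-- With R = 1/(N − m) one has 1 − N R = −m R: the eigenvalue N/(N − m) with its denominator cleared.
rescaled-⇔ : ∀ N m R X Y → R * (N - m) ≡ 1ℚ →
             (X ≡ (1ℚ - N * R) * Y ⇔ (N - m) * (- X) ≡ m * Y)
rescaled-⇔ N m R X Y R[N-m]≡1 = mk⇔
  (λ X≡ → begin
    (N - m) * (- X)
      ≡⟨ cong (λ t → (N - m) * (- t)) X≡ ⟩
    (N - m) * (- ((1ℚ - N * R) * Y))
      ≡⟨ solve 4 (λ N m R Y → (N :- m) :* (:- ((con 1ℚ :- N :* R) :* Y))
                              := (N :* (R :* (N :- m)) :- (N :- m)) :* Y) refl N m R Y ⟩
    (N * (R * (N - m)) - (N - m)) * Y
      ≡⟨ cong (λ t → (N * t - (N - m)) * Y) R[N-m]≡1 ⟩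
    (N * 1ℚ - (N - m)) * Y
      ≡⟨ solve 3 (λ N m Y → (N :* con 1ℚ :- (N :- m)) :* Y := m :* Y) refl N m Y ⟩
    m * Y
      ∎)
  (λ eq → begin
    X
      ≡⟨ sym (*-identityˡ X) ⟩
    1ℚ * X
      ≡⟨ cong (_* X) (sym R[N-m]≡1) ⟩
    R * (N - m) * X
      ≡⟨ solve 4 (λ N m R X → R :* (N :- m) :* X := :- (R :* ((N :- m) :* (:- X)))) refl N m R X ⟩
    - (R * ((N - m) * (- X)))
      ≡⟨ cong (λ t → - (R * t)) eq ⟩
    - (R * (m * Y))
      ≡⟨ solve 4 (λ N m R Y → :- (R :* (m :* Y)) := (R :* (N :- m) :- N :* R) :* Y) refl N m R Y ⟩
    (R * (N - m) - N * R) * Y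
      ≡⟨ cong (λ t → (t - N * R) * Y) R[N-m]≡1 ⟩
    (1ℚ - N * R) * Y
      ∎)

balance-⇔ : ∀ N m k S a →
            ((N - m) * (- (S - k * a)) ≡ m * ((N - k) * a)) ⇔ (N * ((k - m) * a) ≡ (N - m) * S)
balance-⇔ N m k S a = difference-⇔
  (solve 5 (λ N m k S a → (N :- m) :* (:- (S :- k :* a)) :- m :* ((N :- k) :* a)
                          := N :* ((k :- m) :* a) :- (N :- m) :* S) refl N m k S a)

if-yes : ∀ {P A : Set} (p? : Dec P) {x y : A} → P → (if does p? then x else y) ≡ x
if-yes p? p = cong (λ b → if b then _ else _) (dec-true p? p)

if-no : ∀ {P A : Set} (p? : Dec P) {x y : A} → ¬ P → (if does p? then x else y) ≡ y
if-no p? ¬p = cong (λ b → if b then _ else _) (dec-false p? ¬p)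

if-either : ∀ {A : Set} b {x y z : A} → x ≡ z → y ≡ z → (if b then x else y) ≡ z
if-either true  x≡z _   = x≡z
if-either false _   y≡z = y≡z

𝟙 : ∀ {P : Set} → Dec P → ℚ
𝟙 p? = if does p? then 1ℚ else 0ℚ

indicator-difference : ∀ {P Q : Set} (p? : Dec P) (q? : Dec Q) → (P → ¬ Q) →
                       (if does p? then 1ℚ else (if does q? then - 1ℚ else 0ℚ)) ≡ 𝟙 p? - 𝟙 q?
indicator-difference (yes p) (yes q) p⇒¬q = ⊥-elim (p⇒¬q p q)
indicator-difference (yes _) (no _)  _    = refl
indicator-difference (no _)  (yes _) _    = refl
indicator-difference (no _)  (no _)  _    = refl

-- Sums over the parts and over the vertices are assembled from sums over Fin by Σ-summation, so
-- ∑ parts and ∑ vertices unfold definitionally to sumPart and sumV.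
record Summation (X : Set) : Set where
  field
    ∑      : (X → ℚ) → ℚ
    ∑-cong : ∀ {f g} → (∀ x → f x ≡ g x) → ∑ f ≡ ∑ g
    ∑-+    : ∀ f g → ∑ (λ x → f x + g x) ≡ ∑ f + ∑ g
    ∑-*    : ∀ c f → ∑ (λ x → c * f x) ≡ c * ∑ f
    ∑-zero : ∀ f → (∀ x → f x ≡ 0ℚ) → ∑ f ≡ 0ℚ
    ∑-δ    : ∀ x f → (∀ y → y ≢ x → f y ≡ 0ℚ) → ∑ f ≡ f x
    ∑-comm : ∀ m (h : Fin m → X → ℚ) → ∑ (λ x → sumℚ m (λ j → h j x)) ≡ sumℚ m (λ j → ∑ (h j))

  ∑-neg : ∀ f → ∑ (λ x → - f x) ≡ - ∑ f
  ∑-neg f = begin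
    ∑ (λ x → - f x)       ≡⟨ ∑-cong (λ x → sym (-1*x≈-x (f x))) ⟩
    ∑ (λ x → - 1ℚ * f x)  ≡⟨ ∑-* (- 1ℚ) f ⟩
    - 1ℚ * ∑ f            ≡⟨ -1*x≈-x (∑ f) ⟩
    - ∑ f                 ∎

  ∑-minus : ∀ f g → ∑ (λ x → f x - g x) ≡ ∑ f - ∑ g
  ∑-minus f g = trans (∑-+ f (λ x → - g x)) (cong (∑ f +_) (∑-neg g))

  ∑-*ʳ : ∀ f c → ∑ (λ x → f x * c) ≡ ∑ f * c
  ∑-*ʳ f c = trans (∑-cong (λ x → *-comm (f x) c)) (trans (∑-* c f) (*-comm c (∑ f)))

  ∑-const : ∀ c → ∑ (λ _ → c) ≡ ∑ (λ _ → 1ℚ) * c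
  ∑-const c = trans (∑-cong (λ _ → sym (*-identityˡ c))) (∑-*ʳ (λ _ → 1ℚ) c)

open Summation

sumℚ-cong : ∀ m {f g : Fin m → ℚ} → (∀ i → f i ≡ g i) → sumℚ m f ≡ sumℚ m g
sumℚ-cong zero    f≡g = refl
sumℚ-cong (suc m) f≡g = cong₂ _+_ (f≡g zero) (sumℚ-cong m (f≡g ∘ suc))

sumℚ-+ : ∀ m (f g : Fin m → ℚ) → sumℚ m (λ i → f i + g i) ≡ sumℚ m f + sumℚ m g
sumℚ-+ zero    f g = refl
sumℚ-+ (suc m) f g = begin
  (f zero + g zero) + sumℚ m (λ i → f (suc i) + g (suc i))
    ≡⟨ cong ((f zero + g zero) +_) (sumℚ-+ m (f ∘ suc) (g ∘ suc)) ⟩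
  (f zero + g zero) + (sumℚ m (f ∘ suc) + sumℚ m (g ∘ suc))
    ≡⟨ solve 4 (λ a b c d → (a :+ b) :+ (c :+ d) := (a :+ c) :+ (b :+ d)) refl (f zero) (g zero) _ _ ⟩
  (f zero + sumℚ m (f ∘ suc)) + (g zero + sumℚ m (g ∘ suc))
    ∎

sumℚ-* : ∀ m c (f : Fin m → ℚ) → sumℚ m (λ i → c * f i) ≡ c * sumℚ m f
sumℚ-* zero    c f = sym (*-zeroʳ c)
sumℚ-* (suc m) c f = trans (cong (c * f zero +_) (sumℚ-* m c (f ∘ suc))) (sym (*-distribˡ-+ c (f zero) _))

sumℚ-zero : ∀ m (f : Fin m → ℚ) → (∀ i → f i ≡ 0ℚ) → sumℚ m f ≡ 0ℚ
sumℚ-zero zero    f f≡0 = refl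
sumℚ-zero (suc m) f f≡0 = cong₂ _+_ (f≡0 zero) (sumℚ-zero m (f ∘ suc) (f≡0 ∘ suc))

sumℚ-δ : ∀ m (a : Fin m) (f : Fin m → ℚ) → (∀ i → i ≢ a → f i ≡ 0ℚ) → sumℚ m f ≡ f a
sumℚ-δ (suc m) zero    f f≡0 = begin
  f zero + sumℚ m (f ∘ suc)  ≡⟨ cong (f zero +_) (sumℚ-zero m (f ∘ suc) (λ i → f≡0 (suc i) λ ())) ⟩
  f zero + 0ℚ                ≡⟨ +-identityʳ (f zero) ⟩
  f zero                     ∎
sumℚ-δ (suc m) (suc a) f f≡0 = begin
  f zero + sumℚ m (f ∘ suc)
    ≡⟨ cong₂ _+_ (f≡0 zero λ ()) (sumℚ-δ m a (f ∘ suc) (λ i i≢a → f≡0 (suc i) (i≢a ∘ suc-injective))) ⟩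
  0ℚ + f (suc a)
    ≡⟨ +-identityˡ (f (suc a)) ⟩
  f (suc a)
    ∎

sumℚ-comm : ∀ m k (h : Fin k → Fin m → ℚ) →
            sumℚ m (λ i → sumℚ k (λ j → h j i)) ≡ sumℚ k (λ j → sumℚ m (h j))
sumℚ-comm zero    k h = sym (sumℚ-zero k (λ _ → 0ℚ) (λ _ → refl))
sumℚ-comm (suc m) k h = begin
  sumℚ k (λ j → h j zero) + sumℚ m (λ i → sumℚ k (λ j → h j (suc i)))
    ≡⟨ cong (sumℚ k (λ j → h j zero) +_) (sumℚ-comm m k (λ j → h j ∘ suc)) ⟩
  sumℚ k (λ j → h j zero) + sumℚ k (λ j → sumℚ m (h j ∘ suc))
    ≡⟨ sym (sumℚ-+ k (λ j → h j zero) _) ⟩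
  sumℚ k (λ j → h j zero + sumℚ m (h j ∘ suc))
    ∎

sumℚ-const : ∀ m c → sumℚ m (λ _ → c) ≡ fromℕ m * c
sumℚ-const zero    c = sym (*-zeroˡ c)
sumℚ-const (suc m) c = begin
  c + sumℚ m (λ _ → c)  ≡⟨ cong (c +_) (sumℚ-const m c) ⟩
  c + fromℕ m * c       ≡⟨ solve 2 (λ c a → c :+ a :* c := (con 1ℚ :+ a) :* c) refl c (fromℕ m) ⟩
  (1ℚ + fromℕ m) * c    ≡⟨ cong (_* c) (sym (fromℕ-suc m)) ⟩
  fromℕ (suc m) * c     ∎

finSummation : ∀ m → Summation (Fin m)
finSummation m = record
  { ∑      = sumℚ m
  ; ∑-cong = sumℚ-cong m
  ; ∑-+    = sumℚ-+ m
  ; ∑-*    = sumℚ-* m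
  ; ∑-zero = sumℚ-zero m
  ; ∑-δ    = sumℚ-δ m
  ; ∑-comm = sumℚ-comm m
  }

Σ-summation : ∀ {A : Set} {B : A → Set} → Summation A → (∀ a → Summation (B a)) → Summation (Σ A B)
Σ-summation {A} {B} SA SB = record
  { ∑      = ∑ₓ
  ; ∑-cong = λ f≡g → ∑-cong SA (λ a → ∑-cong (SB a) (λ b → f≡g (a , b)))
  ; ∑-+    = λ f g → trans (∑-cong SA (λ a → ∑-+ (SB a) _ _)) (∑-+ SA _ _)
  ; ∑-*    = λ c f → trans (∑-cong SA (λ a → ∑-* (SB a) c _)) (∑-* SA c _)
  ; ∑-zero = λ f f≡0 → ∑-zero SA _ (λ a → ∑-zero (SB a) _ (λ b → f≡0 (a , b)))
  ; ∑-δ    = ∑ₓ-δ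
  ; ∑-comm = λ m h → trans (∑-cong SA (λ a → ∑-comm (SB a) m _)) (∑-comm SA m _)
  }
  where
  ∑ₓ : (Σ A B → ℚ) → ℚ
  ∑ₓ f = ∑ SA (λ a → ∑ (SB a) (λ b → f (a , b)))

  ∑ₓ-δ : ∀ x f → (∀ y → y ≢ x → f y ≡ 0ℚ) → ∑ₓ f ≡ f x
  ∑ₓ-δ (a , b) f f≡0 = trans
    (∑-δ SA a _ (λ a′ a′≢a → ∑-zero (SB a′) _ (λ b′ → f≡0 (a′ , b′) (a′≢a ∘ ,-injectiveˡ))))
    (∑-δ (SB a) b _ (λ b′ b′≢b → f≡0 (a , b′) (b′≢b ∘ ,-injectiveʳ-UIP uip)))

fromℕ-sumℕ : ∀ m (f : Fin m → ℕ) → fromℕ (sumℕ m f) ≡ sumℚ m (fromℕ ∘ f)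
fromℕ-sumℕ zero    f = refl
fromℕ-sumℕ (suc m) f = trans (fromℕ-+ (f zero) _) (cong (fromℕ (f zero) +_) (fromℕ-sumℕ m (f ∘ suc)))

sumℕ≡0⇒≡0 : ∀ m (f : Fin m → ℕ) → sumℕ m f ≡ 0 → ∀ i → f i ≡ 0
sumℕ≡0⇒≡0 (suc m) f eq zero    = ℕ.m+n≡0⇒m≡0 (f zero) eq
sumℕ≡0⇒≡0 (suc m) f eq (suc i) = sumℕ≡0⇒≡0 m (f ∘ suc) (ℕ.m+n≡0⇒n≡0 (f zero) eq) i

module CompleteMultipartite (p : ℕ) (n θ : Fin p → ℕ) where

  V : Set
  V = Vertex p n θ

  classOf : V → Fin p
  classOf v = proj₁ (proj₁ v)

  parts : Summation (Part p θ)
  parts = Σ-summation (finSummation p) (finSummation ∘ θ)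

  vertices : Summation V
  vertices = Σ-summation parts (λ P → finSummation (n (proj₁ P)))

  N : ℕ
  N = numVertices p n θ

  partSum : (V → ℚ) → Part p θ → ℚ
  partSum f P = sumℚ (n (proj₁ P)) (λ a → f (P , a))

  deg : V → ℚ
  deg v = fromℕ N - fromℕ (n (classOf v))

  sumV-restrict : ∀ P f → sumV p n θ (λ w → if does (P ≟P proj₁ w) then f w else 0ℚ) ≡ partSum f P
  sumV-restrict P f = trans
    (∑-δ parts P _ (λ Q Q≢P → sumℚ-zero (n (proj₁ Q)) _ (λ a → if-no (P ≟P Q) (Q≢P ∘ sym))))
    (sumℚ-cong (n (proj₁ P)) (λ a → if-yes (P ≟P P) refl))

  neighbourSum≡ : ∀ f v → neighbourSum p n θ f v ≡ sumV p n θ f - partSum f (proj₁ v)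
  neighbourSum≡ f v = begin
    neighbourSum p n θ f v
      ≡⟨ ∑-cong vertices split ⟩
    sumV p n θ (λ w → f w - (if does (proj₁ v ≟P proj₁ w) then f w else 0ℚ))
      ≡⟨ ∑-minus vertices f _ ⟩
    sumV p n θ f - sumV p n θ (λ w → if does (proj₁ v ≟P proj₁ w) then f w else 0ℚ)
      ≡⟨ cong (λ t → sumV p n θ f - t) (sumV-restrict (proj₁ v) f) ⟩
    sumV p n θ f - partSum f (proj₁ v)
      ∎
    where
    split : ∀ w → (if does (proj₁ v ≟P proj₁ w) then 0ℚ else f w)
                  ≡ f w - (if does (proj₁ v ≟P proj₁ w) then f w else 0ℚ)
    split w with proj₁ v ≟P proj₁ w
    ... | yes _ = sym (+-inverseʳ (f w))
    ... | no  _ = sym (+-identityʳ (f w))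

  fromℕ-N : fromℕ N ≡ sumV p n θ (λ _ → 1ℚ)
  fromℕ-N = trans (fromℕ-sumℕ p _) (sumℚ-cong p λ i → begin
    fromℕ (θ i ℕ.* n i)                       ≡⟨ fromℕ-* (θ i) (n i) ⟩
    fromℕ (θ i) * fromℕ (n i)                 ≡⟨ cong (fromℕ (θ i) *_) (sym (*-identityʳ _)) ⟩
    fromℕ (θ i) * (fromℕ (n i) * 1ℚ)          ≡⟨ sym (sumℚ-const (θ i) _) ⟩
    sumℚ (θ i) (λ _ → fromℕ (n i) * 1ℚ)       ≡⟨ sumℚ-cong (θ i) (λ _ → sym (sumℚ-const (n i) 1ℚ)) ⟩
    sumℚ (θ i) (λ _ → sumℚ (n i) (λ _ → 1ℚ))  ∎)

  fromℕ-sumVℕ : ∀ g → fromℕ (sumVℕ p n θ g) ≡ sumV p n θ (fromℕ ∘ g)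
  fromℕ-sumVℕ g = trans (fromℕ-sumℕ p _) (sumℚ-cong p λ i →
    trans (fromℕ-sumℕ (θ i) _) (sumℚ-cong (θ i) λ j → fromℕ-sumℕ (n i) _))

  fromℕ-degree : ∀ v → fromℕ (degree p n θ v) ≡ deg v
  fromℕ-degree v = begin
    fromℕ (degree p n θ v)
      ≡⟨ fromℕ-sumVℕ (adjℕ v) ⟩
    sumV p n θ (fromℕ ∘ adjℕ v)
      ≡⟨ ∑-cong vertices (λ w → if-float fromℕ (does (proj₁ v ≟P proj₁ w))) ⟩
    neighbourSum p n θ (λ _ → 1ℚ) v
      ≡⟨ neighbourSum≡ (λ _ → 1ℚ) v ⟩
    sumV p n θ (λ _ → 1ℚ) - partSum (λ _ → 1ℚ) (proj₁ v)
      ≡⟨ cong₂ _-_ (sym fromℕ-N) (trans (sumℚ-const (n (classOf v)) 1ℚ) (*-identityʳ _)) ⟩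
    deg v
      ∎

  degree+n≡N : ∀ v → degree p n θ v ℕ.+ n (classOf v) ≡ N
  degree+n≡N v = fromℕ-injective (begin
    fromℕ (degree p n θ v ℕ.+ n (classOf v))        ≡⟨ fromℕ-+ (degree p n θ v) (n (classOf v)) ⟩
    fromℕ (degree p n θ v) + fromℕ (n (classOf v))  ≡⟨ cong (_+ fromℕ (n (classOf v))) (fromℕ-degree v) ⟩
    deg v + fromℕ (n (classOf v))                   ≡⟨ solve 2 (λ x y → (x :- y) :+ y := x) refl (fromℕ N) _ ⟩
    fromℕ N                                         ∎)

  degree≡N∸n : ∀ v → degree p n θ v ≡ N ∸ n (classOf v)
  degree≡N∸n v = trans (sym (ℕ.m+n∸n≡m (degree p n θ v) (n (classOf v))))
                       (cong (_∸ n (classOf v)) (degree+n≡N v))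

  fromℕ-numParts : fromℕ (numParts p θ) ≡ ∑ parts (λ _ → 1ℚ)
  fromℕ-numParts = trans (fromℕ-sumℕ p θ) (sumℚ-cong p λ i →
    trans (sym (*-identityʳ _)) (sym (sumℚ-const (θ i) 1ℚ)))

  sumVℕ≡0⇒≡0 : ∀ g → sumVℕ p n θ g ≡ 0 → ∀ w → g w ≡ 0
  sumVℕ≡0⇒≡0 g eq ((i , j) , a) =
    sumℕ≡0⇒≡0 (n i) _ (sumℕ≡0⇒≡0 (θ i) _ (sumℕ≡0⇒≡0 p _ eq i) j) a

  adjℕ≡0⇒samePart : ∀ v w → adjℕ {p} {n} {θ} v w ≡ 0 → proj₁ v ≡ proj₁ w
  adjℕ≡0⇒samePart v w eq with proj₁ v ≟P proj₁ w | eq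
  ... | yes samePart | _ = samePart
  ... | no  _        | ()

  ZeroPartSums : (V → ℚ) → Set
  ZeroPartSums f = ∀ P → partSum f P ≡ 0ℚ

  ConstantOnParts : (V → ℚ) → Set
  ConstantOnParts f = ∀ P a b → f (P , a) ≡ f (P , b)

  record BalancedOnClass (i : Fin p) (f : V → ℚ) : Set where
    field
      constantOnParts  : ConstantOnParts f
      vanishesOffClass : ∀ v → classOf v ≢ i → f v ≡ 0ℚ
      sum≡0            : sumV p n θ f ≡ 0ℚ

  balanced-respects : ∀ i {f h} → (∀ u → f u ≡ h u) → BalancedOnClass i h → BalancedOnClass i f
  balanced-respects i f≗h balanced = record
    { constantOnParts  = λ P a b → trans (f≗h (P , a)) (trans (constantOnParts P a b) (sym (f≗h (P , b))))
    ; vanishesOffClass = λ u u∉i → trans (f≗h u) (vanishesOffClass u u∉i)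
    ; sum≡0            = trans (∑-cong vertices f≗h) sum≡0
    }
    where open BalancedOnClass balanced

  partSum-constant : ∀ f → ConstantOnParts f → ∀ v → partSum f (proj₁ v) ≡ fromℕ (n (classOf v)) * f v
  partSum-constant f constant (P , a) =
    trans (sumℚ-cong (n (proj₁ P)) (λ b → constant P b a)) (sumℚ-const (n (proj₁ P)) (f (P , a)))

  G : (i : Fin p) → Fin (θ i) → Fin (θ i) → V → ℚ
  G = gFun {p} {n} {θ}

  GCombination : (i : Fin p) → (Fin (θ i) → Fin (θ i) → ℚ) → V → ℚ
  GCombination i c u =
    sumℚ (θ i) (λ j → sumℚ (θ i) (λ k → if does (j ≟ k) then 0ℚ else c j k * G i j k u))

  G-indicators : ∀ i {j k} → j ≢ k → ∀ u → G i j k u ≡ 𝟙 (proj₁ u ≟P (i , j)) - 𝟙 (proj₁ u ≟P (i , k))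
  G-indicators i j≢k u = indicator-difference (proj₁ u ≟P (i , _)) (proj₁ u ≟P (i , _))
    (λ u∈j u∈k → j≢k (,-injectiveʳ-UIP uip (trans (sym u∈j) u∈k)))

  G-offClass : ∀ i j k u → classOf u ≢ i → G i j k u ≡ 0ℚ
  G-offClass i j k u u∉i = trans (if-no (proj₁ u ≟P (i , j)) (u∉i ∘ cong proj₁))
                                 (if-no (proj₁ u ≟P (i , k)) (u∉i ∘ cong proj₁))

  sumV-indicator : ∀ Q → sumV p n θ (λ u → 𝟙 (proj₁ u ≟P Q)) ≡ fromℕ (n (proj₁ Q))
  sumV-indicator Q = begin
    sumV p n θ (λ u → 𝟙 (proj₁ u ≟P Q))
      ≡⟨ ∑-δ parts Q _ (λ P P≢Q → sumℚ-zero (n (proj₁ P)) _ (λ _ → if-no (P ≟P Q) P≢Q)) ⟩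
    sumℚ (n (proj₁ Q)) (λ _ → 𝟙 (Q ≟P Q))
      ≡⟨ sumℚ-cong (n (proj₁ Q)) (λ _ → if-yes (Q ≟P Q) refl) ⟩
    sumℚ (n (proj₁ Q)) (λ _ → 1ℚ)
      ≡⟨ trans (sumℚ-const (n (proj₁ Q)) 1ℚ) (*-identityʳ _) ⟩
    fromℕ (n (proj₁ Q))
      ∎

  sumV-G : ∀ i {j k} → j ≢ k → sumV p n θ (G i j k) ≡ 0ℚ
  sumV-G i {j} {k} j≢k = begin
    sumV p n θ (G i j k)
      ≡⟨ ∑-cong vertices (G-indicators i j≢k) ⟩
    sumV p n θ (λ u → 𝟙 (proj₁ u ≟P (i , j)) - 𝟙 (proj₁ u ≟P (i , k)))
      ≡⟨ ∑-minus vertices _ _ ⟩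
    sumV p n θ (λ u → 𝟙 (proj₁ u ≟P (i , j))) - sumV p n θ (λ u → 𝟙 (proj₁ u ≟P (i , k)))
      ≡⟨ cong₂ _-_ (sumV-indicator (i , j)) (sumV-indicator (i , k)) ⟩
    fromℕ (n i) - fromℕ (n i)
      ≡⟨ +-inverseʳ (fromℕ (n i)) ⟩
    0ℚ
      ∎

  GCombination-balanced : ∀ i c → BalancedOnClass i (GCombination i c)
  GCombination-balanced i c = record
    { constantOnParts  = λ P a b → refl
    ; vanishesOffClass = λ u u∉i → sumℚ-zero (θ i) _ λ j → sumℚ-zero (θ i) _ λ k →
        if-either (does (j ≟ k)) refl (trans (cong (c j k *_) (G-offClass i j k u u∉i)) (*-zeroʳ (c j k)))
    ; sum≡0            = begin
        sumV p n θ (GCombination i c)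
          ≡⟨ ∑-comm vertices (θ i) _ ⟩
        sumℚ (θ i) (λ j → sumV p n θ (λ u → sumℚ (θ i) (λ k → term j k u)))
          ≡⟨ sumℚ-cong (θ i) (λ j → ∑-comm vertices (θ i) _) ⟩
        sumℚ (θ i) (λ j → sumℚ (θ i) (λ k → sumV p n θ (term j k)))
          ≡⟨ sumℚ-zero (θ i) _ (λ j → sumℚ-zero (θ i) _ (sumV-term j)) ⟩
        0ℚ
          ∎
    }
    where
    term : Fin (θ i) → Fin (θ i) → V → ℚ
    term j k u = if does (j ≟ k) then 0ℚ else c j k * G i j k u

    sumV-term : ∀ j k → sumV p n θ (term j k) ≡ 0ℚ
    sumV-term j k with j ≟ k
    ... | yes _  = ∑-zero vertices _ (λ _ → refl)
    ... | no j≢k = trans (∑-* vertices (c j k) (G i j k))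
                         (trans (cong (c j k *_) (sumV-G i j≢k)) (*-zeroʳ (c j k)))

  F : V → V → V → ℚ
  F = fFun {p} {n} {θ}

  FCombination : (V → V → ℚ) → V → ℚ
  FCombination c u = sumV p n θ (λ v → sumV p n θ (λ w →
    if does (proj₁ v ≟P proj₁ w) then (if does (v ≟V w) then 0ℚ else c v w * F v w u) else 0ℚ))

  F-indicators : ∀ {v w} → v ≢ w → ∀ u → F v w u ≡ 𝟙 (u ≟V v) - 𝟙 (u ≟V w)
  F-indicators v≢w u = indicator-difference (u ≟V _) (u ≟V _) (λ u≡v u≡w → v≢w (trans (sym u≡v) u≡w))

  partSum-indicator : ∀ P x → Dec (P ≡ proj₁ x) → partSum (λ u → 𝟙 (u ≟V x)) P ≡ 𝟙 (P ≟P proj₁ x)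
  partSum-indicator P x (no P≢x) = trans
    (sumℚ-zero (n (proj₁ P)) _ (λ a → if-no ((P , a) ≟V x) (P≢x ∘ cong proj₁)))
    (sym (if-no (P ≟P proj₁ x) P≢x))
  partSum-indicator P (.P , b) (yes refl) = begin
    partSum (λ u → 𝟙 (u ≟V (P , b))) P
      ≡⟨ sumℚ-δ (n (proj₁ P)) b _ (λ a a≢b → if-no ((P , a) ≟V (P , b)) (a≢b ∘ ,-injectiveʳ-UIP uip)) ⟩
    𝟙 ((P , b) ≟V (P , b))
      ≡⟨ trans (if-yes ((P , b) ≟V (P , b)) refl) (sym (if-yes (P ≟P P) refl)) ⟩
    𝟙 (P ≟P P)
      ∎

  FCombination-zeroPartSums : ∀ c → ZeroPartSums (FCombination c)
  FCombination-zeroPartSums c P = begin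
    partSum (FCombination c) P
      ≡⟨ sym (∑-comm vertices (n (proj₁ P)) _) ⟩
    sumV p n θ (λ v → sumℚ (n (proj₁ P)) (λ a → sumV p n θ (λ w → term v w (P , a))))
      ≡⟨ ∑-cong vertices (λ v → sym (∑-comm vertices (n (proj₁ P)) _)) ⟩
    sumV p n θ (λ v → sumV p n θ (λ w → partSum (term v w) P))
      ≡⟨ ∑-zero vertices _ (λ v → ∑-zero vertices _ (partSum-term v)) ⟩
    0ℚ
      ∎
    where
    term : V → V → V → ℚ
    term v w u = if does (proj₁ v ≟P proj₁ w) then (if does (v ≟V w) then 0ℚ else c v w * F v w u) else 0ℚ

    𝟙∈P : V → ℚ
    𝟙∈P x = partSum (λ u → 𝟙 (u ≟V x)) P

    partSum-term : ∀ v w → partSum (term v w) P ≡ 0ℚ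
    partSum-term v w with proj₁ v ≟P proj₁ w | v ≟V w
    ... | no _         | _      = sumℚ-zero (n (proj₁ P)) _ (λ _ → refl)
    ... | yes _        | yes _  = sumℚ-zero (n (proj₁ P)) _ (λ _ → refl)
    ... | yes samePart | no v≢w = begin
      partSum (λ u → c v w * F v w u) P
        ≡⟨ sumℚ-* (n (proj₁ P)) (c v w) _ ⟩
      c v w * partSum (F v w) P
        ≡⟨ cong (c v w *_) (sumℚ-cong (n (proj₁ P)) (λ a → F-indicators v≢w (P , a))) ⟩
      c v w * partSum (λ u → 𝟙 (u ≟V v) - 𝟙 (u ≟V w)) P
        ≡⟨ cong (c v w *_) (∑-minus (finSummation (n (proj₁ P))) _ _) ⟩
      c v w * (𝟙∈P v - 𝟙∈P w)
        ≡⟨ cong (λ t → c v w * (t - 𝟙∈P w)) (begin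
             𝟙∈P v                ≡⟨ partSum-indicator P v (P ≟P proj₁ v) ⟩
             𝟙 (P ≟P proj₁ v)     ≡⟨ cong (λ Q → 𝟙 (P ≟P Q)) samePart ⟩
             𝟙 (P ≟P proj₁ w)     ≡⟨ partSum-indicator P w (P ≟P proj₁ w) ⟨
             𝟙∈P w                ∎) ⟩
      c v w * (𝟙∈P w - 𝟙∈P w)
        ≡⟨ cong (c v w *_) (+-inverseʳ (𝟙∈P w)) ⟩
      c v w * 0ℚ
        ≡⟨ *-zeroʳ (c v w) ⟩
      0ℚ
        ∎

  module NonemptyParts (n≥1 : ∀ i → 1 ≤ n i) where

    basePoint : Part p θ → V
    basePoint P = P , fromℕ< (n≥1 (proj₁ P))

    partValues-sum≡0 : ∀ i f → BalancedOnClass i f → sumℚ (θ i) (λ j → f (basePoint (i , j))) ≡ 0ℚ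
    partValues-sum≡0 i f balanced = x*y≡0⇒y≡0 (fromℕ (n i)) (fromℕ-nonZero (n≥1 i)) (begin
      fromℕ (n i) * sumℚ (θ i) (λ j → f (basePoint (i , j)))
        ≡⟨ sym (sumℚ-* (θ i) (fromℕ (n i)) (λ j → f (basePoint (i , j)))) ⟩
      sumℚ (θ i) (λ j → fromℕ (n i) * f (basePoint (i , j)))
        ≡⟨ sym (sumℚ-δ p i _ (λ g g≢i → sumℚ-zero (θ g) _ (λ j → offClass g j g≢i))) ⟩
      ∑ parts (λ P → fromℕ (n (proj₁ P)) * f (basePoint P))
        ≡⟨ sym (∑-cong parts (λ P → partSum-constant f constantOnParts (basePoint P))) ⟩
      sumV p n θ f
        ≡⟨ sum≡0 ⟩
      0ℚ
        ∎)
      where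
      open BalancedOnClass balanced
      offClass : ∀ g j → g ≢ i → fromℕ (n g) * f (basePoint (g , j)) ≡ 0ℚ
      offClass g j g≢i = trans (cong (fromℕ (n g) *_) (vanishesOffClass (basePoint (g , j)) g≢i))
                               (*-zeroʳ (fromℕ (n g)))

    balanced⇒inSpanG : ∀ i → 1 ≤ θ i → ∀ f → BalancedOnClass i f → InSpanG p n θ i f
    balanced⇒inSpanG i θᵢ≥1 f balanced = c , λ u → sym (GCombination≡f u)
      where
      open BalancedOnClass balanced

      k₀ : Fin (θ i)
      k₀ = fromℕ< θᵢ≥1

      value : Fin (θ i) → ℚ
      value j = f (basePoint (i , j))

      c : Fin (θ i) → Fin (θ i) → ℚ
      c j k = if does (k ≟ k₀) then value j else 0ℚ

      𝟙[_∈_] : V → Fin (θ i) → ℚ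
      𝟙[ u ∈ j ] = 𝟙 (proj₁ u ≟P (i , j))

      term-k₀ : ∀ u j → (if does (j ≟ k₀) then 0ℚ else c j k₀ * G i j k₀ u)
                        ≡ value j * (𝟙[ u ∈ j ] - 𝟙[ u ∈ k₀ ])
      term-k₀ u j with j ≟ k₀
      ... | yes refl = sym (trans (cong (value j *_) (+-inverseʳ 𝟙[ u ∈ j ])) (*-zeroʳ (value j)))
      ... | no j≢k₀  = cong₂ _*_ (if-yes (k₀ ≟ k₀) refl) (G-indicators i j≢k₀ u)

      row : ∀ u j → sumℚ (θ i) (λ k → if does (j ≟ k) then 0ℚ else c j k * G i j k u)
                    ≡ value j * (𝟙[ u ∈ j ] - 𝟙[ u ∈ k₀ ])
      row u j = trans
        (sumℚ-δ (θ i) k₀ _ (λ k k≢k₀ → if-either (does (j ≟ k)) refl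
          (trans (cong (_* G i j k u) (if-no (k ≟ k₀) k≢k₀)) (*-zeroˡ (G i j k u)))))
        (term-k₀ u j)

      expand : ∀ u → Dec (classOf u ≡ i) → sumℚ (θ i) (λ j → value j * 𝟙[ u ∈ j ]) ≡ f u
      expand u (no u∉i) = trans
        (sumℚ-zero (θ i) _ (λ j → trans (cong (value j *_) (if-no (proj₁ u ≟P (i , j)) (u∉i ∘ cong proj₁)))
                                        (*-zeroʳ (value j))))
        (sym (vanishesOffClass u u∉i))
      expand u@((.i , l) , a) (yes refl) = begin
        sumℚ (θ i) (λ j → value j * 𝟙[ u ∈ j ])
          ≡⟨ sumℚ-δ (θ i) l _ (λ j j≢l →
               trans (cong (value j *_) (if-no ((i , l) ≟P (i , j)) (j≢l ∘ sym ∘ ,-injectiveʳ-UIP uip)))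
                     (*-zeroʳ (value j))) ⟩
        value l * 𝟙[ u ∈ l ]
          ≡⟨ trans (cong (value l *_) (if-yes ((i , l) ≟P (i , l)) refl)) (*-identityʳ (value l)) ⟩
        value l
          ≡⟨ constantOnParts (i , l) _ a ⟩
        f u
          ∎

      GCombination≡f : ∀ u → GCombination i c u ≡ f u
      GCombination≡f u = begin
        GCombination i c u
          ≡⟨ sumℚ-cong (θ i) (row u) ⟩
        sumℚ (θ i) (λ j → value j * (𝟙[ u ∈ j ] - 𝟙[ u ∈ k₀ ]))
          ≡⟨ sumℚ-cong (θ i) (λ j → x[y-z]≈xy-xz (value j) 𝟙[ u ∈ j ] 𝟙[ u ∈ k₀ ]) ⟩
        sumℚ (θ i) (λ j → value j * 𝟙[ u ∈ j ] - value j * 𝟙[ u ∈ k₀ ])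
          ≡⟨ ∑-minus (finSummation (θ i)) _ _ ⟩
        sumℚ (θ i) (λ j → value j * 𝟙[ u ∈ j ]) - sumℚ (θ i) (λ j → value j * 𝟙[ u ∈ k₀ ])
          ≡⟨ cong₂ _-_ (expand u (classOf u ≟ i)) (∑-*ʳ (finSummation (θ i)) value 𝟙[ u ∈ k₀ ]) ⟩
        f u - sumℚ (θ i) value * 𝟙[ u ∈ k₀ ]
          ≡⟨ cong (λ t → f u - t * 𝟙[ u ∈ k₀ ]) (partValues-sum≡0 i f balanced) ⟩
        f u - 0ℚ * 𝟙[ u ∈ k₀ ]
          ≡⟨ solve 2 (λ x y → x :- con 0ℚ :* y := x) refl (f u) 𝟙[ u ∈ k₀ ] ⟩
        f u
          ∎

    zeroPartSums⇒inSpanF : ∀ f → ZeroPartSums f → InSpanF p n θ f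
    zeroPartSums⇒inSpanF f zeroSums = c , λ u → sym (FCombination≡f u)
      where
      base : V → V
      base v = basePoint (proj₁ v)

      c : V → V → ℚ
      c v w = if does (w ≟V base v) then f v else 0ℚ

      term : V → V → V → ℚ
      term v w u = if does (proj₁ v ≟P proj₁ w) then (if does (v ≟V w) then 0ℚ else c v w * F v w u) else 0ℚ

      term-base : ∀ u v → Dec (v ≡ base v) → term v (base v) u ≡ f v * (𝟙 (u ≟V v) - 𝟙 (u ≟V base v))
      term-base u v (yes v≡b) = begin
        term v (base v) u
          ≡⟨ trans (if-yes (proj₁ v ≟P proj₁ v) refl) (if-yes (v ≟V base v) v≡b) ⟩
        0ℚ
          ≡⟨ sym (trans (cong (f v *_) (+-inverseʳ (𝟙 (u ≟V v)))) (*-zeroʳ (f v))) ⟩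
        f v * (𝟙 (u ≟V v) - 𝟙 (u ≟V v))
          ≡⟨ cong (λ x → f v * (𝟙 (u ≟V v) - 𝟙 (u ≟V x))) v≡b ⟩
        f v * (𝟙 (u ≟V v) - 𝟙 (u ≟V base v))
          ∎
      term-base u v (no v≢b) = begin
        term v (base v) u
          ≡⟨ trans (if-yes (proj₁ v ≟P proj₁ v) refl) (if-no (v ≟V base v) v≢b) ⟩
        c v (base v) * F v (base v) u
          ≡⟨ cong₂ _*_ (if-yes (base v ≟V base v) refl) (F-indicators v≢b u) ⟩
        f v * (𝟙 (u ≟V v) - 𝟙 (u ≟V base v))
          ∎

      row : ∀ u v → sumV p n θ (λ w → term v w u) ≡ f v * (𝟙 (u ≟V v) - 𝟙 (u ≟V base v))
      row u v = trans
        (∑-δ vertices (base v) _ (λ w w≢b → if-either (does (proj₁ v ≟P proj₁ w))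
          (if-either (does (v ≟V w)) refl
            (trans (cong (_* F v w u) (if-no (w ≟V base v) w≢b)) (*-zeroˡ (F v w u))))
          refl))
        (term-base u v (v ≟V base v))

      diagonal : ∀ u → sumV p n θ (λ v → f v * 𝟙 (u ≟V v)) ≡ f u
      diagonal u = trans
        (∑-δ vertices u _ (λ v v≢u → trans (cong (f v *_) (if-no (u ≟V v) (v≢u ∘ sym))) (*-zeroʳ (f v))))
        (trans (cong (f u *_) (if-yes (u ≟V u) refl)) (*-identityʳ (f u)))

      atBase : V → Part p θ → ℚ
      atBase u P = 𝟙 (u ≟V basePoint P)

      throughBase : ∀ u → sumV p n θ (λ v → f v * 𝟙 (u ≟V base v)) ≡ 0ℚ
      throughBase u = trans
        (∑-cong parts (λ P → ∑-*ʳ (finSummation (n (proj₁ P))) (λ a → f (P , a)) (atBase u P)))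
        (∑-zero parts _ (λ P → trans (cong (_* (atBase u P)) (zeroSums P)) (*-zeroˡ (atBase u P))))

      FCombination≡f : ∀ u → FCombination c u ≡ f u
      FCombination≡f u = begin
        FCombination c u
          ≡⟨ ∑-cong vertices (row u) ⟩
        sumV p n θ (λ v → f v * (𝟙 (u ≟V v) - 𝟙 (u ≟V base v)))
          ≡⟨ ∑-cong vertices (λ v → x[y-z]≈xy-xz (f v) (𝟙 (u ≟V v)) (𝟙 (u ≟V base v))) ⟩
        sumV p n θ (λ v → f v * 𝟙 (u ≟V v) - f v * 𝟙 (u ≟V base v))
          ≡⟨ ∑-minus vertices _ _ ⟩
        sumV p n θ (λ v → f v * 𝟙 (u ≟V v)) - sumV p n θ (λ v → f v * 𝟙 (u ≟V base v))
          ≡⟨ cong₂ _-_ (diagonal u) (throughBase u) ⟩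
        f u - 0ℚ
          ≡⟨ +-identityʳ (f u) ⟩
        f u
          ∎

    inSpanF-⇔ : ∀ f → InSpanF p n θ f ⇔ ZeroPartSums f
    inSpanF-⇔ f = mk⇔
      (λ (c , f≗) P → trans (sumℚ-cong (n (proj₁ P)) (λ a → f≗ (P , a))) (FCombination-zeroPartSums c P))
      (zeroPartSums⇒inSpanF f)

    inSpanG-⇔ : ∀ i → 1 ≤ θ i → ∀ f → InSpanG p n θ i f ⇔ BalancedOnClass i f
    inSpanG-⇔ i θᵢ≥1 f = mk⇔
      (λ (c , f≗) → balanced-respects i f≗ (GCombination-balanced i c))
      (balanced⇒inSpanG i θᵢ≥1 f)

    module AtLeastTwoParts (parts≥2 : 2 ≤ numParts p θ) where

      numParts≢1 : numParts p θ ≢ 1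
      numParts≢1 eq with subst (2 ≤_) eq parts≥2
      ... | s≤s ()

      degree≢0 : ∀ v → degree p n θ v ≢ 0
      degree≢0 v deg≡0 = numParts≢1 (fromℕ-injective (trans fromℕ-numParts
        (∑-δ parts (proj₁ v) _ (λ Q Q≢P → ⊥-elim (Q≢P (sym (isolated Q)))))))
        where
        isolated : ∀ Q → proj₁ v ≡ Q
        isolated Q = adjℕ≡0⇒samePart v (basePoint Q)
                       (sumVℕ≡0⇒≡0 (adjℕ {p} {n} {θ} v) deg≡0 (basePoint Q))

      recipℕ-degree : ∀ v → recipℕ (degree p n θ v) * deg v ≡ 1ℚ
      recipℕ-degree v = subst (λ d → recipℕ (degree p n θ v) * d ≡ 1ℚ) (fromℕ-degree v)
        (recipℕ-inverseˡ (degree p n θ v) (ℕ.n≢0⇒n>0 (degree≢0 v)))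

      deg≢0 : ∀ v → deg v ≢ 0ℚ
      deg≢0 v = inverse⇒≢0 {recipℕ (degree p n θ v)} (recipℕ-degree v)

      laplacian-⇔ : ∀ μ f v → (laplacian p n θ f v ≡ μ * f v)
                              ⇔ (sumV p n θ f - partSum f (proj₁ v) ≡ (1ℚ - μ) * (deg v * f v))
      laplacian-⇔ μ f v =
        subst (λ L → (L ≡ μ * f v) ⇔ (X ≡ (1ℚ - μ) * (deg v * f v)))
              (cong (λ Y → f v - recipℕ (degree p n θ v) * Y) (sym (neighbourSum≡ f v)))
              (eigenvalueEquation-⇔ {recipℕ (degree p n θ v)} {deg v} (f v) X μ (recipℕ-degree v))
        where
        X : ℚ
        X = sumV p n θ f - partSum f (proj₁ v)

      eigenvalueOne-⇔ : ∀ f → (∀ v → laplacian p n θ f v ≡ 1ℚ * f v) ⇔ ZeroPartSums f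
      eigenvalueOne-⇔ f = mk⇔ partSums-vanish eigenfunction
        where
        S : ℚ
        S = sumV p n θ f

        partSums-vanish : (∀ v → laplacian p n θ f v ≡ 1ℚ * f v) → ZeroPartSums f
        partSums-vanish eig P = trans (partSum≡S P) S≡0
          where
          partSum≡S : ∀ Q → partSum f Q ≡ S
          partSum≡S Q = sym (x∙y⁻¹≈ε⇒x≈y S (partSum f Q)
            (trans (to (laplacian-⇔ 1ℚ f (basePoint Q)) (eig (basePoint Q)))
                   (*-zeroˡ (deg (basePoint Q) * f (basePoint Q)))))
          S≡0 : S ≡ 0ℚ
          S≡0 = x*y≡y⇒y≡0 (fromℕ (numParts p θ)) (numParts≢1 ∘ fromℕ-injective) (sym (begin
            S                         ≡⟨ ∑-cong parts partSum≡S ⟩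
            ∑ parts (λ _ → S)         ≡⟨ ∑-const parts S ⟩
            ∑ parts (λ _ → 1ℚ) * S    ≡⟨ cong (_* S) (sym fromℕ-numParts) ⟩
            fromℕ (numParts p θ) * S  ∎))

        eigenfunction : ZeroPartSums f → ∀ v → laplacian p n θ f v ≡ 1ℚ * f v
        eigenfunction zeroSums v = from (laplacian-⇔ 1ℚ f v) (begin
          S - partSum f (proj₁ v)  ≡⟨ cong₂ _-_ (∑-zero parts _ zeroSums) (zeroSums (proj₁ v)) ⟩
          0ℚ                       ≡⟨ sym (*-zeroˡ (deg v * f v)) ⟩
          0ℚ * (deg v * f v)       ∎)

      module EigenvalueOfClass (n-injective : ∀ i j → n i ≡ n j → i ≡ j) (i : Fin p) (θᵢ≥1 : 1 ≤ θ i) where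

        m : ℚ
        m = fromℕ (n i)

        vᵢ : V
        vᵢ = basePoint (i , fromℕ< θᵢ≥1)

        R-inverse : recipℕ (N ∸ n i) * (fromℕ N - m) ≡ 1ℚ
        R-inverse = subst (λ k → recipℕ k * deg vᵢ ≡ 1ℚ) (degree≡N∸n vᵢ) (recipℕ-degree vᵢ)

        N≢0 : fromℕ N ≢ 0ℚ
        N≢0 = fromℕ-nonZero (subst (1 ≤_) (degree+n≡N vᵢ) (ℕ.≤-trans (n≥1 i) (ℕ.m≤n+m (n i) _)))

        EigenCondition : (V → ℚ) → V → Set
        EigenCondition f v = (fromℕ N - m) * (- (sumV p n θ f - partSum f (proj₁ v))) ≡ m * (deg v * f v)

        laplacian-λ-⇔ : ∀ f v → (laplacian p n θ f v ≡ frac N (N ∸ n i) * f v) ⇔ EigenCondition f v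
        laplacian-λ-⇔ f v =
          rescaled-⇔ (fromℕ N) m (recipℕ (N ∸ n i)) _ (deg v * f v) R-inverse
          ⇔-∘ laplacian-⇔ (frac N (N ∸ n i)) f v

        BalanceEquation : (V → ℚ) → V → Set
        BalanceEquation f v = fromℕ N * ((fromℕ (n (classOf v)) - m) * f v) ≡ (fromℕ N - m) * sumV p n θ f

        eigenCondition⇒constant : ∀ f → (∀ v → EigenCondition f v) → ConstantOnParts f
        eigenCondition⇒constant f cond P a b =
          *-cancelˡ-≢0 (deg (P , a)) (deg≢0 (P , a))
            (*-cancelˡ-≢0 m (fromℕ-nonZero (n≥1 i)) (trans (sym (cond (P , a))) (cond (P , b))))

        eigenCondition-⇔ : ∀ f → ConstantOnParts f → ∀ v → EigenCondition f v ⇔ BalanceEquation f v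
        eigenCondition-⇔ f constant v =
          subst (λ X → ((fromℕ N - m) * (- (sumV p n θ f - X)) ≡ m * (deg v * f v)) ⇔ BalanceEquation f v)
                (sym (partSum-constant f constant v))
                (balance-⇔ (fromℕ N) m (fromℕ (n (classOf v))) (sumV p n θ f) (f v))

        eigenCondition⇒balanced : ∀ f → (∀ v → EigenCondition f v) → BalancedOnClass i f
        eigenCondition⇒balanced f cond = record
          { constantOnParts  = constant
          ; vanishesOffClass = vanishes
          ; sum≡0            = S≡0
          }
          where
          constant : ConstantOnParts f
          constant = eigenCondition⇒constant f cond

          balance : ∀ v → BalanceEquation f v
          balance v = to (eigenCondition-⇔ f constant v) (cond v)

          S≡0 : sumV p n θ f ≡ 0ℚ
          S≡0 = x*y≡0⇒y≡0 (fromℕ N - m) (inverse⇒≢0 {recipℕ (N ∸ n i)} R-inverse) (begin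
            (fromℕ N - m) * sumV p n θ f  ≡⟨ sym (balance vᵢ) ⟩
            fromℕ N * ((m - m) * f vᵢ)    ≡⟨ cong (λ t → fromℕ N * (t * f vᵢ)) (+-inverseʳ m) ⟩
            fromℕ N * (0ℚ * f vᵢ)         ≡⟨ cong (fromℕ N *_) (*-zeroˡ (f vᵢ)) ⟩
            fromℕ N * 0ℚ                  ≡⟨ *-zeroʳ (fromℕ N) ⟩
            0ℚ                            ∎)

          vanishes : ∀ v → classOf v ≢ i → f v ≡ 0ℚ
          vanishes v v∉i =
            x*y≡0⇒y≡0 (fromℕ (n (classOf v)) - m) (x≢y⇒x-y≢0 (v∉i ∘ n-injective _ _ ∘ fromℕ-injective))
              (x*y≡0⇒y≡0 (fromℕ N) N≢0
                (trans (balance v) (trans (cong ((fromℕ N - m) *_) S≡0) (*-zeroʳ (fromℕ N - m)))))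

        balanced⇒eigenCondition : ∀ f → BalancedOnClass i f → ∀ v → EigenCondition f v
        balanced⇒eigenCondition f balanced v = from (eigenCondition-⇔ f constantOnParts v) (begin
          fromℕ N * ((fromℕ (n (classOf v)) - m) * f v)  ≡⟨ cong (fromℕ N *_) (factor≡0 (classOf v ≟ i)) ⟩
          fromℕ N * 0ℚ                                   ≡⟨ *-zeroʳ (fromℕ N) ⟩
          0ℚ                                             ≡⟨ sym (*-zeroʳ (fromℕ N - m)) ⟩
          (fromℕ N - m) * 0ℚ                             ≡⟨ cong ((fromℕ N - m) *_) sum≡0 ⟨
          (fromℕ N - m) * sumV p n θ f                   ∎)
          where
          open BalancedOnClass balanced
          factor≡0 : Dec (classOf v ≡ i) → (fromℕ (n (classOf v)) - m) * f v ≡ 0ℚ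
          factor≡0 (yes v∈i) = trans (cong (λ g → (fromℕ (n g) - m) * f v) v∈i)
                                     (trans (cong (_* f v) (+-inverseʳ m)) (*-zeroˡ (f v)))
          factor≡0 (no v∉i)  = trans (cong ((fromℕ (n (classOf v)) - m) *_) (vanishesOffClass v v∉i))
                                     (*-zeroʳ (fromℕ (n (classOf v)) - m))

        eigenvalue-⇔ : ∀ f → (∀ v → laplacian p n θ f v ≡ frac N (N ∸ n i) * f v) ⇔ BalancedOnClass i f
        eigenvalue-⇔ f = mk⇔
          (λ eig → eigenCondition⇒balanced f (λ v → to (laplacian-λ-⇔ f v) (eig v)))
          (λ balanced v → from (laplacian-λ-⇔ f v) (balanced⇒eigenCondition f balanced v))

mainTheorem4 :
  (p : ℕ) (n θ : Fin p → ℕ) →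
  (∀ i → 1 ≤ n i) →
  (∀ i j → n i ≡ n j → i ≡ j) →
  (∀ i → 1 ≤ θ i) →
  2 ≤ numParts p θ →
  ((i : Fin p) → (f : Vertex p n θ → ℚ) →
     IsEigenfunction p n θ
       (frac (numVertices p n θ) (numVertices p n θ ∸ n i)) f
     ⇔ ((∃ λ v → ¬ f v ≡ 0ℚ) × InSpanG p n θ i f))
  ×
  ((f : Vertex p n θ → ℚ) →
     IsEigenfunction p n θ 1ℚ f
     ⇔ ((∃ λ v → ¬ f v ≡ 0ℚ) × InSpanF p n θ f))
mainTheorem4 p n θ n≥1 n-injective θ≥1 parts≥2 = eigenvalueOfClass , eigenvalueOne
  where
  open CompleteMultipartite p n θ
  open NonemptyParts n≥1
  open AtLeastTwoParts parts≥2

  eigenvalueOfClass : ∀ i f → IsEigenfunction p n θ (frac N (N ∸ n i)) f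
                              ⇔ ((∃ λ v → f v ≢ 0ℚ) × InSpanG p n θ i f)
  eigenvalueOfClass i f =
    ⇔-id _ ×-⇔ (⇔-sym (inSpanG-⇔ i (θ≥1 i) f) ⇔-∘ EigenvalueOfClass.eigenvalue-⇔ n-injective i (θ≥1 i) f)

  eigenvalueOne : ∀ f → IsEigenfunction p n θ 1ℚ f ⇔ ((∃ λ v → f v ≢ 0ℚ) × InSpanF p n θ f)
  eigenvalueOne f = ⇔-id _ ×-⇔ (⇔-sym (inSpanF-⇔ f) ⇔-∘ eigenvalueOne-⇔ f)
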